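{- Every tree $T$ has a core of order at most $12\Delta(T)$. If moreover $\Delta(T)\leq\sqrt{|V(T)|}/12$, then $T$ has a core of order exactly $12\Delta(T)$.
   Context: For a tree $T$ with maximum degree $\Delta(T)$ and degrees $d_T(v)$, an induced subforest $T_{core}$ of $T$ is a core of $T$ if for every $d\leq\Delta(T)$ at least one of the following holds: (I) $T_{core}$ contains all vertices $v$ of $T$ with $d_T(v)=d$; (II) both $T_{core}$ and $T\setminus V(T_{core})$ contain at least $6$ vertices $v$ with $d_T(v)=d$. The order of $T_{core}$ is its number of vertices. -}

module Defs where

open import Data.Nat using (ℕ; zero; suc; _+_; _*_; _≤_; _⊔_; _≡ᵇ_)
open import Data.Bool using (Bool; true; false; _∧_; not; if_then_else_)
open import Data.Fin using (Fin; zero; suc)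
open import Data.List using (List; []; _∷_; length)
open import Data.List.Relation.Unary.Unique.Propositional using (Unique)
open import Data.Product using (Σ; _×_; ∃)
open import Data.Sum using (_⊎_)
open import Data.Unit using (⊤)
open import Data.Empty using (⊥)
open import Relation.Nullary using (¬_)
open import Relation.Binary.PropositionalEquality using (_≡_)

record SimpleGraph (n : ℕ) : Set where
  field
    adj    : Fin n → Fin n → Bool
    sym    : ∀ u v → adj u v ≡ adj v u
    irrefl : ∀ v → adj v v ≡ false

module _ {n : ℕ} (G : SimpleGraph n) where
  open SimpleGraph G

  Adj : Fin n → Fin n → Set
  Adj u v = adj u v ≡ true

  data Walk : Fin n → Fin n → Set where
    here : ∀ {u} → Walk u u
    step : ∀ {u w v} → Adj u w → Walk w v → Walk u v

  Connected : Set
  Connected = ∀ u v → Walk u v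

  Chain : List (Fin n) → Set
  Chain [] = ⊤
  Chain (x ∷ []) = ⊤
  Chain (x ∷ y ∷ l) = Adj x y × Chain (y ∷ l)

  lastOf : Fin n → List (Fin n) → Fin n
  lastOf x [] = x
  lastOf x (y ∷ ys) = lastOf y ys

  HasCycle : Set
  HasCycle = Σ (Fin n) λ x → Σ (List (Fin n)) λ xs →
    Unique (x ∷ xs) × (2 ≤ length xs) × Chain (x ∷ xs) × Adj (lastOf x xs) x

  Acyclic : Set
  Acyclic = ¬ HasCycle

countF : ∀ {n} → (Fin n → Bool) → ℕ
countF {zero} p = 0
countF {suc n} p = (if p zero then 1 else 0) + countF (λ i → p (suc i))

maxF : ∀ {n} → (Fin n → ℕ) → ℕ
maxF {zero} f = 0
maxF {suc n} f = f zero ⊔ maxF (λ i → f (suc i))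

IsTree : ∀ {n} → SimpleGraph n → Set
IsTree {n} G = (1 ≤ n) × Connected G × Acyclic G

degree : ∀ {n} → SimpleGraph n → Fin n → ℕ
degree G v = countF (SimpleGraph.adj G v)

maxDegree : ∀ {n} → SimpleGraph n → ℕ
maxDegree G = maxF (degree G)

-- A vertex subset S (the vertex set of the induced subforest T_core);
-- its order is the number of vertices it contains.
order : ∀ {n} → (Fin n → Bool) → ℕ
order S = countF S

countDeg : ∀ {n} → SimpleGraph n → (Fin n → Bool) → ℕ → ℕ
countDeg G S d = countF (λ v → S v ∧ (degree G v ≡ᵇ d))

IsCore : ∀ {n} → SimpleGraph n → (Fin n → Bool) → Set
IsCore {n} G S = ∀ d → 1 ≤ d → d ≤ maxDegree G →
    (∀ v → degree G v ≡ d → S v ≡ true)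
  ⊎ ((6 ≤ countDeg G S d) × (6 ≤ countDeg G (λ v → not (S v)) d))

-- Only the numbers c_d of vertices of each degree d matter.
-- A vertex set containing x of the c_d vertices of degree d satisfies the core condition at d
-- iff x = c_d or 6 ≤ x ≤ c_d − 6, and taking the first q_d vertices of each degree realises any
-- quotas q_d ≤ c_d. For each d choose an interval of admissible quotas whose lower end is at
-- most 12 and whose upper end is at least c_d − 6: the lower ends give a core of order at most
-- 12Δ, the upper ends sum to at least n − 6Δ ≥ 144Δ² − 6Δ ≥ 12Δ, and distributing the
-- difference greedily between the two ends hits 12Δ exactly.
module Submission where

open import Defs
open import Data.Nat using (ℕ; zero; suc; _+_; _*_; _∸_; _≤_; _<_; _≮_; _⊓_; _≡ᵇ_; _<ᵇ_; z≤n; s≤s; s<s; _<?_)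
open import Data.Nat.Properties
open import Algebra.Properties.CommutativeSemigroup +-commutativeSemigroup using (interchange)
open import Data.Bool using (Bool; true; false; _∧_; not; if_then_else_; T)
open import Data.Bool.Properties using (∧-zeroʳ)
open import Data.Fin using (Fin; zero; suc)
open import Data.Product using (Σ; ∃-syntax; _×_; _,_; proj₂)
open import Data.Sum using (_⊎_; inj₁; inj₂)
open import Data.Empty using (⊥-elim)
open import Function using (_∘_)
open import Relation.Nullary using (yes; no)
open import Relation.Binary.PropositionalEquality

countF-const-true : ∀ n → countF {n} (λ _ → true) ≡ n
countF-const-true zero = refl
countF-const-true (suc n) = cong suc (countF-const-true n)

countF≡0⇒false : ∀ {n} (p : Fin n → Bool) → countF p ≡ 0 → ∀ v → p v ≡ false
countF≡0⇒false {suc n} p eq v with p zero in pz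
countF≡0⇒false {suc n} p eq zero    | false = pz
countF≡0⇒false {suc n} p eq (suc v) | false = countF≡0⇒false (p ∘ suc) eq v

countF-partition : ∀ {n} (S p : Fin n → Bool) →
  countF p ≡ countF (λ v → S v ∧ p v) + countF (λ v → not (S v) ∧ p v)
countF-partition {zero} S p = refl
countF-partition {suc n} S p with S zero | p zero | countF-partition (S ∘ suc) (p ∘ suc)
... | true  | false | ih = ih
... | false | false | ih = ih
... | true  | true  | ih = cong suc ih
... | false | true  | ih = trans (cong suc ih) (sym (+-suc _ _))

maxF-upperBound : ∀ {n} (f : Fin n → ℕ) v → f v ≤ maxF f
maxF-upperBound {suc n} f zero    = m≤m⊔n _ _
maxF-upperBound {suc n} f (suc v) = ≤-trans (maxF-upperBound (f ∘ suc) v) (m≤n⊔m _ _)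

∑ : ℕ → (ℕ → ℕ) → ℕ
∑ zero    h = 0
∑ (suc m) h = h 0 + ∑ m (h ∘ suc)

syntax ∑ m (λ d → x) = ∑[ d < m ] x

∑-cong : ∀ m {h g : ℕ → ℕ} → (∀ d → h d ≡ g d) → ∑ m h ≡ ∑ m g
∑-cong zero    eq = refl
∑-cong (suc m) eq = cong₂ _+_ (eq 0) (∑-cong m (eq ∘ suc))

∑-mono-≤ : ∀ m {h g : ℕ → ℕ} → (∀ d → h d ≤ g d) → ∑ m h ≤ ∑ m g
∑-mono-≤ zero    le = z≤n
∑-mono-≤ (suc m) le = +-mono-≤ (le 0) (∑-mono-≤ m (le ∘ suc))

∑-distrib-+ : ∀ m (h g : ℕ → ℕ) → ∑[ d < m ] (h d + g d) ≡ ∑ m h + ∑ m g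
∑-distrib-+ zero    h g = refl
∑-distrib-+ (suc m) h g = trans (cong (h 0 + g 0 +_) (∑-distrib-+ m (h ∘ suc) (g ∘ suc)))
                                (interchange (h 0) (g 0) _ _)

∑-const : ∀ m k → ∑[ d < m ] k ≡ m * k
∑-const zero    k = refl
∑-const (suc m) k = cong (k +_) (∑-const m k)

∑-zero : ∀ m → ∑[ d < m ] 0 ≡ 0
∑-zero m = trans (∑-const m 0) (*-zeroʳ m)

∑-indicator : ∀ {k m} → k < m → ∑[ d < m ] (if k ≡ᵇ d then 1 else 0) ≡ 1
∑-indicator {zero}  {suc m} _         = cong suc (∑-zero m)
∑-indicator {suc k} {suc m} (s<s k<m) = ∑-indicator k<m

countF-byValue : ∀ {n m} (f : Fin n → ℕ) (g : Fin n → Bool) → (∀ v → f v < m) →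
  countF g ≡ ∑[ d < m ] countF (λ v → g v ∧ (f v ≡ᵇ d))
countF-byValue {zero}  {m} f g _ = sym (∑-zero m)
countF-byValue {suc n} {m} f g f<m with g zero
... | false = countF-byValue (f ∘ suc) (g ∘ suc) (f<m ∘ suc)
... | true  = begin
  1 + countF (g ∘ suc)
    ≡⟨ cong₂ _+_ (∑-indicator (f<m zero)) (sym (countF-byValue (f ∘ suc) (g ∘ suc) (f<m ∘ suc))) ⟨
  ∑[ d < m ] (if f zero ≡ᵇ d then 1 else 0) + ∑[ d < m ] countF (λ v → g (suc v) ∧ (f (suc v) ≡ᵇ d))
    ≡⟨ ∑-distrib-+ m _ _ ⟨
  ∑[ d < m ] ((if f zero ≡ᵇ d then 1 else 0) + countF (λ v → g (suc v) ∧ (f (suc v) ≡ᵇ d)))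
    ∎
  where open ≡-Reasoning

decrementAt : ℕ → (ℕ → ℕ) → ℕ → ℕ
decrementAt k q d = if k ≡ᵇ d then q d ∸ 1 else q d

select : ∀ {n} → (Fin n → ℕ) → (ℕ → ℕ) → Fin n → Bool
select f q zero    = 0 <ᵇ q (f zero)
select f q (suc v) = select (f ∘ suc) (decrementAt (f zero) q) v

select-step : ∀ k d (q : ℕ → ℕ) r →
  (if (0 <ᵇ q k) ∧ (k ≡ᵇ d) then 1 else 0) + decrementAt k q d ⊓ r ≡ q d ⊓ ((if k ≡ᵇ d then 1 else 0) + r)
select-step zero    zero    q r with q 0
... | zero  = refl
... | suc _ = refl
select-step zero    (suc d) q r rewrite ∧-zeroʳ (0 <ᵇ q 0)       = refl
select-step (suc k) zero    q r rewrite ∧-zeroʳ (0 <ᵇ q (suc k)) = refl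
select-step (suc k) (suc d) q r = select-step k d (q ∘ suc) r

select-count : ∀ {n} (f : Fin n → ℕ) q d →
  countF (λ v → select f q v ∧ (f v ≡ᵇ d)) ≡ q d ⊓ countF (λ v → f v ≡ᵇ d)
select-count {zero}  f q d = sym (⊓-zeroʳ (q d))
select-count {suc n} f q d =
  trans (cong ((if (0 <ᵇ q (f zero)) ∧ (f zero ≡ᵇ d) then 1 else 0) +_)
              (select-count (f ∘ suc) (decrementAt (f zero) q) d))
        (select-step (f zero) d q _)

greedyFill : (ℕ → ℕ) → ℕ → ℕ → ℕ
greedyFill w s zero    = w 0 ⊓ s
greedyFill w s (suc d) = greedyFill (w ∘ suc) (s ∸ w 0) d

greedyFill≤ : ∀ w s d → greedyFill w s d ≤ w d
greedyFill≤ w s zero    = m⊓n≤m (w 0) s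
greedyFill≤ w s (suc d) = greedyFill≤ (w ∘ suc) (s ∸ w 0) d

∑-greedyFill : ∀ m w {s} → s ≤ ∑ m w → ∑ m (greedyFill w s) ≡ s
∑-greedyFill zero    w s≤0 = sym (n≤0⇒n≡0 s≤0)
∑-greedyFill (suc m) w {s} s≤∑ =
  trans (cong (w 0 ⊓ s +_) (∑-greedyFill m (w ∘ suc) (m≤n+o⇒m∸n≤o s (w 0) s≤∑))) (m⊓n+n∸m≡n (w 0) s)

∑-interpolate : ∀ m (a b : ℕ → ℕ) {s} → (∀ d → a d ≤ b d) → ∑ m a ≤ s → s ≤ ∑ m b →
  ∃[ x ] (∀ d → a d ≤ x d × x d ≤ b d) × ∑ m x ≡ s
∑-interpolate m a b {s} a≤b ∑a≤s s≤∑b = x , (λ d → m≤m+n (a d) (y d) , x≤b d) , ∑x≡s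
  where
  w : ℕ → ℕ
  w d = b d ∸ a d
  ∑b≡∑a+∑w : ∑ m b ≡ ∑ m a + ∑ m w
  ∑b≡∑a+∑w = trans (∑-cong m (λ d → sym (m+[n∸m]≡n (a≤b d)))) (∑-distrib-+ m a w)
  y : ℕ → ℕ
  y = greedyFill w (s ∸ ∑ m a)
  x : ℕ → ℕ
  x d = a d + y d
  x≤b : ∀ d → x d ≤ b d
  x≤b d = ≤-trans (+-monoʳ-≤ (a d) (greedyFill≤ w _ d)) (≤-reflexive (m+[n∸m]≡n (a≤b d)))
  ∑x≡s : ∑ m x ≡ s
  ∑x≡s = begin
    ∑ m x               ≡⟨ ∑-distrib-+ m a y ⟩
    ∑ m a + ∑ m y       ≡⟨ cong (∑ m a +_) (∑-greedyFill m w (m≤n+o⇒m∸n≤o s (∑ m a) (≤-trans s≤∑b (≤-reflexive ∑b≡∑a+∑w)))) ⟩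
    ∑ m a + (s ∸ ∑ m a) ≡⟨ m+[n∸m]≡n ∑a≤s ⟩
    s                   ∎
    where open ≡-Reasoning

Admissible : ℕ → ℕ → Set
Admissible c x = c ≤ x ⊎ (6 ≤ x × x + 6 ≤ c)

admissible-⊓ : ∀ {c x} → Admissible c x → Admissible c (x ⊓ c)
admissible-⊓ (inj₁ c≤x) = inj₁ (≤-reflexive (sym (m≥n⇒m⊓n≡n c≤x)))
admissible-⊓ {x = x} (inj₂ (6≤x , x+6≤c)) rewrite m≤n⇒m⊓n≡m (m+n≤o⇒m≤o x x+6≤c) = inj₂ (6≤x , x+6≤c)

degreeCount : ∀ {n} → SimpleGraph n → ℕ → ℕ
degreeCount G d = countF (λ v → degree G v ≡ᵇ d)

isCore-if-admissible : ∀ {n} (G : SimpleGraph n) (S : Fin n → Bool) →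
  (∀ d → 1 ≤ d → d ≤ maxDegree G → Admissible (degreeCount G d) (countDeg G S d)) → IsCore G S
isCore-if-admissible G S adm d 1≤d d≤Δ with adm d 1≤d d≤Δ
... | inj₁ c≤x = inj₁ S-contains
  where
  outside≡0 : countDeg G (not ∘ S) d ≡ 0
  outside≡0 = n≤0⇒n≡0 (+-cancelˡ-≤ (countDeg G S d) _ 0
    (≤-trans (≤-reflexive (sym (countF-partition S _))) (≤-trans c≤x (≤-reflexive (sym (+-identityʳ _))))))
  S-contains : ∀ v → degree G v ≡ d → S v ≡ true
  S-contains v deg≡d with S v | countF≡0⇒false _ outside≡0 v
  ... | true  | _         = refl
  ... | false | ≡ᵇ≡false = ⊥-elim (subst T ≡ᵇ≡false (≡⇒≡ᵇ _ _ deg≡d))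
... | inj₂ (6≤x , x+6≤c) =
  inj₂ (6≤x , +-cancelˡ-≤ (countDeg G S d) 6 _ (≤-trans x+6≤c (≤-reflexive (countF-partition S _))))

c≮12⇒c∸6+6≡c : ∀ {c} → c ≮ 12 → c ∸ 6 + 6 ≡ c
c≮12⇒c∸6+6≡c c≮12 = m∸n+n≡m (≤-trans (m≤m+n 6 6) (≮⇒≥ c≮12))

-- For c ≥ 12 the admissible values are c and [6, c ∸ 6]; the quota interval omits c so as to stay an interval.
lowQuota : ℕ → ℕ
lowQuota c with c <? 12
... | yes _ = c
... | no  _ = 6

highQuota : ℕ → ℕ
highQuota c with c <? 12
... | yes _ = c
... | no  _ = c ∸ 6

lowQuota≤12 : ∀ c → lowQuota c ≤ 12
lowQuota≤12 c with c <? 12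
... | yes c<12 = <⇒≤ c<12
... | no  _    = m≤m+n 6 6

lowQuota≤highQuota : ∀ c → lowQuota c ≤ highQuota c
lowQuota≤highQuota c with c <? 12
... | yes _    = ≤-refl
... | no  c≮12 = ∸-monoˡ-≤ 6 (≮⇒≥ c≮12)

highQuota[c]≤c : ∀ c → highQuota c ≤ c
highQuota[c]≤c c with c <? 12
... | yes _ = ≤-refl
... | no  _ = m∸n≤m c 6

c≤highQuota[c]+6 : ∀ c → c ≤ highQuota c + 6
c≤highQuota[c]+6 c with c <? 12
... | yes _    = m≤m+n c 6
... | no  c≮12 = ≤-reflexive (sym (c≮12⇒c∸6+6≡c c≮12))

admissible-quota : ∀ c {x} → lowQuota c ≤ x → x ≤ highQuota c → Admissible c x
admissible-quota c low≤x x≤high with c <? 12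
... | yes _    = inj₁ low≤x
... | no  c≮12 = inj₂ (low≤x , ≤-trans (+-monoˡ-≤ 6 x≤high) (≤-reflexive (c≮12⇒c∸6+6≡c c≮12)))

12m+6m≤144m² : ∀ m → 12 * m + 6 * m ≤ 144 * (m * m)
12m+6m≤144m² zero      = z≤n
12m+6m≤144m² m@(suc _) = begin
  12 * m + 6 * m  ≡⟨ *-distribʳ-+ m 12 6 ⟨
  18 * m          ≤⟨ *-monoˡ-≤ m (m≤m+n 18 126) ⟩
  144 * m         ≤⟨ *-monoʳ-≤ 144 (m≤m*n m m) ⟩
  144 * (m * m)   ∎
  where open ≤-Reasoning

module _ {n} (G : SimpleGraph n) where
  private
    Δ : ℕ
    Δ = maxDegree G

  -- IsCore ignores degree 0; letting its quota reach degreeCount G 0 keeps n ≤ ∑ hiQuota + 6Δ.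
  loQuota hiQuota : ℕ → ℕ
  loQuota zero    = 0
  loQuota (suc d) = lowQuota (degreeCount G (suc d))
  hiQuota zero    = degreeCount G 0
  hiQuota (suc d) = highQuota (degreeCount G (suc d))

  WithinQuota : (ℕ → ℕ) → Set
  WithinQuota q = ∀ d → loQuota d ≤ q d × q d ≤ hiQuota d

  loQuota≤hiQuota : ∀ d → loQuota d ≤ hiQuota d
  loQuota≤hiQuota zero    = z≤n
  loQuota≤hiQuota (suc d) = lowQuota≤highQuota (degreeCount G (suc d))

  hiQuota≤degreeCount : ∀ d → hiQuota d ≤ degreeCount G d
  hiQuota≤degreeCount zero    = ≤-refl
  hiQuota≤degreeCount (suc d) = highQuota[c]≤c (degreeCount G (suc d))

  withinQuota-loQuota : WithinQuota loQuota
  withinQuota-loQuota d = ≤-refl , loQuota≤hiQuota d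

  select-isCore : ∀ q → WithinQuota q → IsCore G (select (degree G) q)
  select-isCore q q-within = isCore-if-admissible G _ admissible
    where
    admissible : ∀ d → 1 ≤ d → d ≤ Δ → Admissible (degreeCount G d) (countDeg G (select (degree G) q) d)
    admissible (suc d) _ _ with q-within (suc d)
    ... | lo≤q , q≤hi = subst (Admissible _) (sym (select-count (degree G) q (suc d)))
                              (admissible-⊓ (admissible-quota _ lo≤q q≤hi))

  order-select : ∀ q → WithinQuota q → order (select (degree G) q) ≡ ∑ (suc Δ) q
  order-select q q-within =
    trans (countF-byValue (degree G) (select (degree G) q) (s≤s ∘ maxF-upperBound (degree G)))
          (∑-cong (suc Δ) λ d → trans (select-count (degree G) q d)
                                      (m≤n⇒m⊓n≡m (≤-trans (proj₂ (q-within d)) (hiQuota≤degreeCount d))))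

  ∑loQuota≤12Δ : ∑ (suc Δ) loQuota ≤ 12 * Δ
  ∑loQuota≤12Δ = begin
    ∑[ d < Δ ] lowQuota (degreeCount G (suc d))  ≤⟨ ∑-mono-≤ Δ (λ d → lowQuota≤12 (degreeCount G (suc d))) ⟩
    ∑[ d < Δ ] 12                                 ≡⟨ ∑-const Δ 12 ⟩
    Δ * 12                                        ≡⟨ *-comm Δ 12 ⟩
    12 * Δ                                        ∎
    where open ≤-Reasoning

  n≤∑hiQuota+6Δ : n ≤ ∑ (suc Δ) hiQuota + 6 * Δ
  n≤∑hiQuota+6Δ = begin
    n                                              ≡⟨ countF-const-true n ⟨
    countF {n} (λ _ → true)                        ≡⟨ countF-byValue (degree G) _ (s≤s ∘ maxF-upperBound (degree G)) ⟩
    c 0 + ∑[ d < Δ ] c (suc d)                     ≤⟨ +-monoʳ-≤ (c 0) (∑-mono-≤ Δ (λ d → c≤highQuota[c]+6 (c (suc d)))) ⟩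
    c 0 + ∑[ d < Δ ] (highQuota (c (suc d)) + 6)   ≡⟨ cong (c 0 +_) (∑-distrib-+ Δ _ _) ⟩
    c 0 + (∑[ d < Δ ] highQuota (c (suc d)) + ∑[ d < Δ ] 6) ≡⟨ +-assoc (c 0) _ _ ⟨
    ∑ (suc Δ) hiQuota + ∑[ d < Δ ] 6               ≡⟨ cong (∑ (suc Δ) hiQuota +_) (trans (∑-const Δ 6) (*-comm Δ 6)) ⟩
    ∑ (suc Δ) hiQuota + 6 * Δ                      ∎
    where
    open ≤-Reasoning
    c : ℕ → ℕ
    c = degreeCount G

  12Δ≤∑hiQuota : 144 * (Δ * Δ) ≤ n → 12 * Δ ≤ ∑ (suc Δ) hiQuota
  12Δ≤∑hiQuota 144Δ²≤n = +-cancelʳ-≤ (6 * Δ) (12 * Δ) _ (≤-trans (12m+6m≤144m² Δ) (≤-trans 144Δ²≤n n≤∑hiQuota+6Δ))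

mainTheorem5 : ∀ (n : ℕ) (T : SimpleGraph n) → IsTree T →
    (Σ (Fin n → Bool) λ S → IsCore T S × order S ≤ 12 * maxDegree T)
  × (144 * (maxDegree T * maxDegree T) ≤ n →
       Σ (Fin n → Bool) λ S → IsCore T S × order S ≡ 12 * maxDegree T)
mainTheorem5 n T _ = (select (degree T) (loQuota T) , select-isCore T _ (withinQuota-loQuota T) , order≤12Δ) , exact
  where
  order≤12Δ : order (select (degree T) (loQuota T)) ≤ 12 * maxDegree T
  order≤12Δ = ≤-trans (≤-reflexive (order-select T _ (withinQuota-loQuota T))) (∑loQuota≤12Δ T)
  exact : 144 * (maxDegree T * maxDegree T) ≤ n → Σ (Fin n → Bool) λ S → IsCore T S × order S ≡ 12 * maxDegree T
  exact 144Δ²≤n with ∑-interpolate (suc (maxDegree T)) (loQuota T) (hiQuota T) (loQuota≤hiQuota T)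
                                   (∑loQuota≤12Δ T) (12Δ≤∑hiQuota T 144Δ²≤n)
  ... | q , q-within , ∑q≡12Δ = select (degree T) q , select-isCore T q q-within , trans (order-select T q q-within) ∑q≡12Δ
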